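{- Let $k$ and $t$ be positive integers with $t\leq k$, and let $\mathbb{F}(k,t)$ be the family of $k$-sets defined in the context below. Then the transversal size of $\mathbb{F}(k,t)$ equals $t$; that is, the minimum cardinality of a set $C$ that intersects every block of $\mathbb{F}(k,t)$ is exactly $t$.
   Context: A family is a collection of finite sets, whose members are called blocks. A blocking set of a nonempty finite family $\mathcal{G}$ is a set $C$ that intersects every block of $\mathcal{G}$; the transversal size of $\mathcal{G}$ is the minimum size of a blocking set of $\mathcal{G}$. Construction of $\mathbb{F}(k,t)$: Let $k,t$ be positive integers with $t\leq k$. Let $X_0,\dots,X_{t-1}$ be $t$ pairwise disjoint sets with $|X_n|=k-\lfloor t/2\rfloor$ if $0\leq n\leq \lfloor (t-1)/2\rfloor$ and $|X_n|=k-\lfloor (t-1)/2\rfloor$ if $\lfloor (t-1)/2\rfloor+1\leq n\leq t-1$. Write $X_n=\{x^n_p : 0\leq p\leq |X_n|-1\}$. Then $\mathbb{F}(k,t)$ is the family of all $k$-sets of the form $$X_n\sqcup\{x^{n+i}_{p_i} : 1\leq i\leq k-|X_n|\},$$ where $0\leq n\leq t-1$, the superscript $n+i$ is taken modulo $t$, and $(p_m)_{m\geq 0}$ ranges over all finite sequences of nonnegative integers satisfying $p_0=0$ and, for each $m\geq 1$, $p_m=p_{m-1}$ or $p_m=1+p_{m-1}$. -}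

module Defs where

open import Data.Nat using (ℕ; zero; suc; _+_; _∸_; _≤_; _<_; _≤?_; ⌊_/2⌋; NonZero)
open import Data.Nat.DivMod using (_%_)
open import Data.Product using (Σ; ∃; _×_; _,_)
open import Data.Sum using (_⊎_)
open import Data.List using (List; length)
open import Data.List.Membership.Propositional using (_∈_)
open import Data.List.Relation.Unary.Unique.Propositional using (Unique)
open import Relation.Nullary using (yes; no)
open import Relation.Binary.PropositionalEquality using (_≡_)

-- Elements x^n_p of the ground set are encoded as pairs (n , p).
Elem : Set
Elem = ℕ × ℕ

-- |X_n| for the construction F(k,t)
sizeX : ℕ → ℕ → ℕ → ℕ
sizeX k t n with n ≤? ⌊ t ∸ 1 /2⌋
... | yes _ = k ∸ ⌊ t /2⌋
... | no  _ = k ∸ ⌊ t ∸ 1 /2⌋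

-- admissible sequences (p_m)_{m ≥ 0}: p_0 = 0 and each step adds 0 or 1
-- (only the values p_0,…,p_len matter).
ValidSeq : ℕ → (ℕ → ℕ) → Set
ValidSeq len p = (p 0 ≡ 0) ×
  (∀ j → 1 ≤ j → j ≤ len → (p j ≡ p (j ∸ 1)) ⊎ (p j ≡ suc (p (j ∸ 1))))

-- membership in the block  X_n ⊔ { x^{n+i}_{p_i} : 1 ≤ i ≤ k - |X_n| }
InBlock : (k t : ℕ) → .{{NonZero t}} → ℕ → (ℕ → ℕ) → Elem → Set
InBlock k t n p (a , b) =
  ((a ≡ n) × (b < sizeX k t n)) ⊎
  (Σ ℕ λ i → (1 ≤ i) × (i ≤ k ∸ sizeX k t n) × (a ≡ (n + i) % t) × (b ≡ p i))

BlocksF : (k t : ℕ) → .{{NonZero t}} → List Elem → Set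
BlocksF k t C = ∀ n p → n < t → ValidSeq (k ∸ sizeX k t n) p →
  ∃ λ x → (x ∈ C) × InBlock k t n p x

-- transversal size of F(k,t) equals s: some blocking set has exactly s
-- elements, and every blocking set has at least s elements.
-- Finite sets are duplicate-free lists; size = length.
TransversalSizeF : (k t : ℕ) → .{{NonZero t}} → ℕ → Set
TransversalSizeF k t s =
  (∃ λ C → Unique C × BlocksF k t C × (length C ≡ s)) ×
  (∀ C → Unique C → BlocksF k t C → s ≤ length C)

module Submission where

-- Upper bound: the first-row cells x^n_0 (n < t) form a blocking set, since
-- every X_n is nonempty when t ≤ k and contains x^n_0.
--
-- Lower bound: let C have fewer than t elements and let g(j) be the number
-- of elements of C in column j mod t.  The column counts over one period
-- sum to less than t, so by the cycle lemma there is a starting column m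
-- from which every run of i+1 consecutive columns m, m+1, … contains at
-- most i elements of C.  In particular X_m misses C.  It then remains to
-- find an admissible sequence p whose cells x^{m+i}_{p_i}, 1 ≤ i ≤ L, all
-- miss C.  The set of rows reachable at column j by such partial sequences
-- grows by one per column and loses at most the number of elements of C
-- in that column; as columns 1..j contain at most j elements of C, it
-- never becomes empty (the avoiding-path lemma).  Hence the block indexed
-- by (m , p) misses C, so C is not blocking.

open import Defs
open import Data.Nat using (ℕ; _≤_; NonZero)
open import Data.Nat using (zero; suc; _+_; _∸_; _<_; z≤n; s≤s; s≤s⁻¹; _≤?_; _<?_; _≡ᵇ_; pred; ⌊_/2⌋; >-nonZero; >-nonZero⁻¹)
open import Data.Nat.Properties
open import Data.Nat.DivMod using (_%_; [m+n]%n≡m%n; m<n⇒m%n≡m)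
open import Data.Nat.Induction using (<-rec)
open import Data.Nat.Solver using (module +-*-Solver)
open import Data.Bool using (Bool; true; false; _∧_; _∨_; not)
open import Data.Bool.Properties using (T-≡; ∨-zeroʳ)
open import Data.Product using (∃; _×_; _,_; proj₁; proj₂)
open import Data.Sum using (_⊎_; inj₁; inj₂)
open import Data.Empty using (⊥-elim)
open import Data.List using (List; []; _∷_; length)
open import Data.List.Membership.Propositional using (_∈_)
open import Data.List.Relation.Unary.Any using (here; there)
open import Data.List.Relation.Unary.All using (All; []; _∷_)
open import Data.List.Relation.Unary.Unique.Propositional using (Unique)
open import Data.List.Relation.Unary.AllPairs using ([]; _∷_)
open import Function.Bundles using (Equivalence)
open import Relation.Nullary using (Dec; yes; no; ¬_)
open import Relation.Binary.PropositionalEquality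
open +-*-Solver using (solve; _:+_; _:=_)

≤-suc-cases : ∀ {y s} → y ≤ suc s → y ≤ s ⊎ y ≡ suc s
≤-suc-cases y≤ with m≤n⇒m<n∨m≡n y≤
... | inj₁ (s≤s y≤s) = inj₁ y≤s
... | inj₂ y≡ = inj₂ y≡

sum< : (ℕ → ℕ) → ℕ → ℕ
sum< f zero    = 0
sum< f (suc n) = sum< f n + f n

sum<-cong : ∀ {f g} n → (∀ j → j < n → f j ≡ g j) → sum< f n ≡ sum< g n
sum<-cong zero    eq = refl
sum<-cong (suc n) eq = cong₂ _+_ (sum<-cong n (λ j j<n → eq j (m≤n⇒m≤1+n j<n))) (eq n ≤-refl)

sum<-mono : ∀ {f g} n → (∀ j → f j ≤ g j) → sum< f n ≤ sum< g n
sum<-mono zero    le = z≤n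
sum<-mono (suc n) le = +-mono-≤ (sum<-mono n le) (le n)

sum<-zero : ∀ n → sum< (λ _ → 0) n ≡ 0
sum<-zero zero    = refl
sum<-zero (suc n) = cong (_+ 0) (sum<-zero n)

sum<-+ : ∀ f g n → sum< (λ j → f j + g j) n ≡ sum< f n + sum< g n
sum<-+ f g zero    = refl
sum<-+ f g (suc n) rewrite sum<-+ f g n =
  solve 4 (λ a b c d → (a :+ b) :+ (c :+ d) := (a :+ c) :+ (b :+ d)) refl
    (sum< f n) (sum< g n) (f n) (g n)

sum<-++ : ∀ f a b → sum< f (a + b) ≡ sum< f a + sum< (λ j → f (a + j)) b
sum<-++ f a zero    = trans (cong (sum< f) (+-identityʳ a)) (sym (+-identityʳ _))
sum<-++ f a (suc b) rewrite +-suc a b | sum<-++ f a b =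
  +-assoc (sum< f a) (sum< (λ j → f (a + j)) b) (f (a + b))

sum<-monoʳ : ∀ f {a b} → a ≤ b → sum< f a ≤ sum< f b
sum<-monoʳ f {a} {b} a≤b = begin
  sum< f a                                     ≤⟨ m≤m+n _ _ ⟩
  sum< f a + sum< (λ j → f (a + j)) (b ∸ a)    ≡⟨ sum<-++ f a (b ∸ a) ⟨
  sum< f (a + (b ∸ a))                         ≡⟨ cong (sum< f) (m+[n∸m]≡n a≤b) ⟩
  sum< f b                                     ∎
  where open ≤-Reasoning

∧-true : ∀ {a b} → a ∧ b ≡ true → a ≡ true × b ≡ true
∧-true {true} {true} refl = refl , refl

∨-true : ∀ {a b} → a ∨ b ≡ true → a ≡ true ⊎ b ≡ true
∨-true {true}  e = inj₁ refl
∨-true {false} e = inj₂ e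

not-true : ∀ {a} → not a ≡ true → a ≡ false
not-true {false} refl = refl

ind : Bool → ℕ
ind true  = 1
ind false = 0

count : (ℕ → Bool) → ℕ → ℕ
count r = sum< (λ q → ind (r q))

≡ᵇ-sound : ∀ m n → (m ≡ᵇ n) ≡ true → m ≡ n
≡ᵇ-sound m n e = ≡ᵇ⇒≡ m n (Equivalence.from T-≡ e)

≡ᵇ-refl : ∀ n → (n ≡ᵇ n) ≡ true
≡ᵇ-refl n = Equivalence.to T-≡ (≡⇒≡ᵇ n n refl)

count-≡ᵇ-below : ∀ b n → n ≤ b → count (_≡ᵇ b) n ≡ 0
count-≡ᵇ-below b zero    _   = refl
count-≡ᵇ-below b (suc n) n<b with n ≡ᵇ b in e
... | true  = ⊥-elim (<-irrefl (≡ᵇ-sound n b e) n<b)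
... | false = cong (_+ 0) (count-≡ᵇ-below b n (<⇒≤ n<b))

count-≡ᵇ : ∀ b n → count (_≡ᵇ b) n ≤ 1
count-≡ᵇ b zero = z≤n
count-≡ᵇ b (suc n) with n ≡ᵇ b in e
... | true  rewrite count-≡ᵇ-below b n (≤-reflexive (≡ᵇ-sound n b e)) = ≤-refl
... | false rewrite +-identityʳ (count (_≡ᵇ b) n) = count-≡ᵇ b n

count-witness : ∀ r n → 1 ≤ count r n → ∃ λ q → q < n × r q ≡ true
count-witness r (suc n) pos with r n in e
... | true  = n , ≤-refl , e
... | false with count-witness r n (subst (1 ≤_) (+-identityʳ _) pos)
... | q , q<n , rq = q , m≤n⇒m≤1+n q<n , rq

shift : (ℕ → Bool) → ℕ → Bool
shift r zero    = false
shift r (suc q) = r q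

-- A nonempty set has a least element, i.e. an element whose predecessor
-- is not in the set.
count-least : ∀ r q → r q ≡ true → 1 ≤ count (λ x → r x ∧ not (shift r x)) (suc q)
count-least r zero    e rewrite e = ≤-refl
count-least r (suc q) e = by-predecessor (r q) refl
  where
    by-predecessor : ∀ b → r q ≡ b → 1 ≤ count (λ x → r x ∧ not (shift r x)) (suc (suc q))
    by-predecessor true  rq = ≤-trans (count-least r q rq) (m≤m+n _ _)
    by-predecessor false rq rewrite e | rq = m≤n+m 1 _

ind-∨ : ∀ a b → ind (a ∨ b) ≤ ind a + ind b
ind-∨ true  b = s≤s z≤n
ind-∨ false b = ≤-refl

ind-∨-disjoint : ∀ a b → ind b + ind (a ∧ not b) ≤ ind (a ∨ b)
ind-∨-disjoint true  true  = ≤-refl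
ind-∨-disjoint true  false = ≤-refl
ind-∨-disjoint false true  = ≤-refl
ind-∨-disjoint false false = ≤-refl

ind-remove : ∀ a u → ind u ≤ ind (not a ∧ u) + ind a
ind-remove true  true  = ≤-refl
ind-remove true  false = z≤n
ind-remove false true  = s≤s z≤n
ind-remove false false = z≤n

count-remove : ∀ f u n → count u n ≤ count (λ q → not (f q) ∧ u q) n + count f n
count-remove f u n = ≤-trans (sum<-mono n (λ q → ind-remove (f q) (u q)))
                             (≤-reflexive (sum<-+ _ _ n))

-- A nonempty set r of rows inside [0, L) gains at least one row when
-- united with its shift (the new maximum), all within [0, L].
count-shift-grows : ∀ r L q → r q ≡ true → q ≤ L → r L ≡ false →
                    suc (count r (suc L)) ≤ count (λ x → r x ∨ shift r x) (suc L)
count-shift-grows r L q rq q≤L rL = begin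
  suc (count r (suc L))
    ≡⟨ cong (λ b → suc (count r L + ind b)) rL ⟩
  suc (count r L + 0)
    ≡⟨ trans (cong suc (+-identityʳ _)) (+-comm 1 _) ⟩
  count r L + 1
    ≤⟨ +-monoʳ-≤ (count r L) (≤-trans (count-least r q rq) (sum<-monoʳ _ (s≤s q≤L))) ⟩
  count r L + count (λ x → r x ∧ not (shift r x)) (suc L)
    ≡⟨ cong (_+ count (λ x → r x ∧ not (shift r x)) (suc L)) (sum<-++ (λ x → ind (shift r x)) 1 L) ⟨
  count (shift r) (suc L) + count (λ x → r x ∧ not (shift r x)) (suc L)
    ≡⟨ sum<-+ _ _ (suc L) ⟨
  sum< (λ x → ind (shift r x) + ind (r x ∧ not (shift r x))) (suc L)
    ≤⟨ sum<-mono (suc L) (λ x → ind-∨-disjoint (r x) (shift r x)) ⟩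
  count (λ x → r x ∨ shift r x) (suc L) ∎
  where open ≤-Reasoning

-- Take m the last maximiser on [0, t) of the excess G y - y, where
-- G y = g 0 + … + g (y ∸ 1); since a full period lowers the excess, m
-- strictly dominates every later point, which is the window bound.

module CycleLemma (t : ℕ) (g : ℕ → ℕ) (periodic : ∀ j → g (t + j) ≡ g j)
                  (deficient : sum< g t < t) where

  G : ℕ → ℕ
  G = sum< g

  -- y ⊑ b: the excess G y - y is at most G b - b (compared without ∸).
  _⊑_ : ℕ → ℕ → Set
  y ⊑ b = G y + b ≤ G b + y

  _⊏_ : ℕ → ℕ → Set
  y ⊏ b = G y + b < G b + y

  ⊑-trans : ∀ {x y z} → x ⊑ y → y ⊑ z → x ⊑ z
  ⊑-trans {x} {y} {z} x⊑y y⊑z = +-cancelʳ-≤ (G y + y) (G x + z) (G z + x) (begin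
    G x + z + (G y + y) ≡⟨ solve 4 (λ a b x z → a :+ z :+ (b :+ x) := (a :+ x) :+ (b :+ z)) refl (G x) (G y) y z ⟩
    (G x + y) + (G y + z) ≤⟨ +-mono-≤ x⊑y y⊑z ⟩
    (G y + x) + (G z + y) ≡⟨ solve 4 (λ b c x y → (b :+ x) :+ (c :+ y) := c :+ x :+ (b :+ y)) refl (G y) (G z) x y ⟩
    G z + x + (G y + y) ∎)
    where open ≤-Reasoning

  _⊑?_ : ∀ y b → Dec (y ⊑ b)
  y ⊑? b = G y + b ≤? G b + y

  LastPeak : ℕ → ℕ → Set
  LastPeak s b = b ≤ s × (∀ y → y ≤ s → y ⊑ b) × (∀ y → b < y → y ≤ s → y ⊏ b)

  lastPeak : ℕ → ℕ
  lastPeak zero = 0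
  lastPeak (suc s) with lastPeak s ⊑? suc s
  ... | yes _ = suc s
  ... | no  _ = lastPeak s

  lastPeak-spec : ∀ s → LastPeak s (lastPeak s)
  lastPeak-spec zero = z≤n , (λ { y z≤n → ≤-refl }) , (λ { y b<y z≤n → ⊥-elim (<-irrefl refl b<y) })
  lastPeak-spec (suc s) with lastPeak s ⊑? suc s | lastPeak-spec s
  ... | yes b⊑new | b≤s , below , _ = ≤-refl , below′ , (λ y new<y y≤new → ⊥-elim (<⇒≱ new<y y≤new))
    where
      below′ : ∀ y → y ≤ suc s → y ⊑ suc s
      below′ y y≤ with ≤-suc-cases y≤
      ... | inj₁ y≤s  = ⊑-trans {y} {lastPeak s} {suc s} (below y y≤s) b⊑new
      ... | inj₂ refl = ≤-refl
  ... | no new⋢b | b≤s , below , after = m≤n⇒m≤1+n b≤s , below′ , after′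
    where
      new⊏b : suc s ⊏ lastPeak s
      new⊏b = ≰⇒> new⋢b
      below′ : ∀ y → y ≤ suc s → y ⊑ lastPeak s
      below′ y y≤ with ≤-suc-cases y≤
      ... | inj₁ y≤s  = below y y≤s
      ... | inj₂ refl = <⇒≤ new⊏b
      after′ : ∀ y → lastPeak s < y → y ≤ suc s → y ⊏ lastPeak s
      after′ y b<y y≤ with ≤-suc-cases y≤
      ... | inj₁ y≤s  = after y b<y y≤s
      ... | inj₂ refl = new⊏b

  t>0 : 0 < t
  t>0 = <-≤-trans (s≤s z≤n) deficient

  m : ℕ
  m = lastPeak (pred t)

  m<t : m < t
  m<t = m≤pred[n]⇒suc[m]≤n {{>-nonZero t>0}} (proj₁ (lastPeak-spec (pred t)))

  G-periodic : ∀ y → G (t + y) ≡ G t + G y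
  G-periodic y = trans (sum<-++ g t y) (cong (G t +_) (sum<-cong y (λ j _ → periodic j)))

  period-drop : ∀ y → y ⊑ m → (t + y) ⊏ m
  period-drop y y⊑m = begin-strict
    G (t + y) + m    ≡⟨ trans (cong (_+ m) (G-periodic y)) (+-assoc (G t) (G y) m) ⟩
    G t + (G y + m)  <⟨ +-mono-<-≤ deficient y⊑m ⟩
    t + (G m + y)    ≡⟨ solve 3 (λ a b c → a :+ (b :+ c) := b :+ (a :+ c)) refl t (G m) y ⟩
    G m + (t + y)    ∎
    where open ≤-Reasoning

  beyond-period : ∀ y → t ≤ y → (y ∸ t) ⊑ m → y ⊏ m
  beyond-period y t≤y prev = subst (_⊏ m) (m+[n∸m]≡n t≤y) (period-drop (y ∸ t) prev)

  everywhere-below : ∀ y → y ⊑ m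
  everywhere-below = <-rec (_⊑ m) step
    where
      step : ∀ y → (∀ {z} → z < y → z ⊑ m) → y ⊑ m
      step y rec with y <? t
      ... | yes y<t = proj₁ (proj₂ (lastPeak-spec (pred t))) y (<⇒≤pred y<t)
      ... | no  y≮t = <⇒≤ (beyond-period y t≤y (rec (∸-monoʳ-< t>0 t≤y)))
        where
          t≤y : t ≤ y
          t≤y = ≮⇒≥ y≮t

  strictly-after : ∀ y → m < y → y ⊏ m
  strictly-after y m<y with y <? t
  ... | yes y<t = proj₂ (proj₂ (lastPeak-spec (pred t))) y m<y (<⇒≤pred y<t)
  ... | no  y≮t = beyond-period y (≮⇒≥ y≮t) (everywhere-below (y ∸ t))

  -- Strictness at m + i + 1 says the window m..m+i holds less than i + 1.
  window-bound : ∀ i → sum< (λ j → g (m + j)) (suc i) ≤ i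
  window-bound i = s≤s⁻¹ (+-cancelˡ-< (G m + m) W (suc i) (begin-strict
    G m + m + W        ≡⟨ solve 3 (λ a b c → a :+ b :+ c := a :+ c :+ b) refl (G m) m W ⟩
    G m + W + m        ≡⟨ cong (_+ m) (sum<-++ g m (suc i)) ⟨
    G (m + suc i) + m  <⟨ strictly-after (m + suc i) (m<m+n m (s≤s z≤n)) ⟩
    G m + (m + suc i)  ≡⟨ +-assoc (G m) m (suc i) ⟨
    G m + m + suc i    ∎))
    where
      open ≤-Reasoning
      W : ℕ
      W = sum< (λ j → g (m + j)) (suc i)

cycle-lemma : ∀ t (g : ℕ → ℕ) → (∀ j → g (t + j) ≡ g j) → sum< g t < t →
              ∃ λ m → m < t × (∀ i → sum< (λ j → g (m + j)) (suc i) ≤ i)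
cycle-lemma t g periodic deficient = m , m<t , window-bound
  where open CycleLemma t g periodic deficient

Avoids : (ℕ → ℕ → Bool) → ℕ → (ℕ → ℕ) → Set
Avoids φ j p = ∀ i → 1 ≤ i → i ≤ j → φ i (p i) ≡ false

module AvoidingPath (φ : ℕ → ℕ → Bool) (L : ℕ) where

  forbidden : ℕ → ℕ
  forbidden i = count (φ i) (suc L)

  forbiddenUpTo : ℕ → ℕ
  forbiddenUpTo j = sum< (λ i → forbidden (suc i)) j

  -- rows reachable at column j by an admissible avoiding sequence
  reach : ℕ → ℕ → Bool
  reach zero    q = q ≡ᵇ 0
  reach (suc j) q = not (φ (suc j) q) ∧ (reach j q ∨ shift (reach j) q)

  #reach : ℕ → ℕ
  #reach j = count (reach j) (suc L)

  -- a path moves up by at most one row per column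
  reach-bound : ∀ j q → reach j q ≡ true → q ≤ j
  reach-bound zero    q e = ≤-reflexive (≡ᵇ-sound q 0 e)
  reach-bound (suc j) q e with ∨-true {reach j q} (proj₂ (∧-true {not (φ (suc j) q)} e))
  ... | inj₁ stay = m≤n⇒m≤1+n (reach-bound j q stay)
  reach-bound (suc j) (suc q) e | inj₂ up = s≤s (reach-bound j q up)

  reach-step : ∀ j → j < L → 1 ≤ #reach j → suc (#reach j) ≤ #reach (suc j) + forbidden (suc j)
  reach-step j j<L nonempty with count-witness (reach j) (suc L) nonempty
  ... | q , q≤L , rq =
    ≤-trans (count-shift-grows (reach j) L q rq (s≤s⁻¹ q≤L) reachL)
            (count-remove (φ (suc j)) (λ x → reach j x ∨ shift (reach j) x) (suc L))
    where
      reachL : reach j L ≡ false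
      reachL with reach j L in e
      ... | true  = ⊥-elim (<⇒≱ j<L (reach-bound j L e))
      ... | false = refl

  extendAt : (ℕ → ℕ) → ℕ → ℕ → ℕ → ℕ
  extendAt p j q i with i ≤? j
  ... | yes _ = p i
  ... | no  _ = q

  extendAt-old : ∀ p j q i → i ≤ j → extendAt p j q i ≡ p i
  extendAt-old p j q i i≤j with i ≤? j
  ... | yes _   = refl
  ... | no  i≰j = ⊥-elim (i≰j i≤j)

  extendAt-new : ∀ p j q → extendAt p j q (suc j) ≡ q
  extendAt-new p j q with suc j ≤? j
  ... | yes sj≤j = ⊥-elim (1+n≰n sj≤j)
  ... | no  _    = refl

  PathTo : ℕ → ℕ → Set
  PathTo j q = ∃ λ p → ValidSeq j p × Avoids φ j p × p j ≡ q

  extend : ∀ j q q′ → PathTo j q′ → φ (suc j) q ≡ false → (q ≡ q′ ⊎ q ≡ suc q′) → PathTo (suc j) q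
  extend j q q′ (p , (p0 , steps) , avoids , pj) free move =
    extendAt p j q , (trans (extendAt-old p j q 0 z≤n) p0 , steps′) , avoids′ , extendAt-new p j q
    where
      steps′ : ∀ i → 1 ≤ i → i ≤ suc j →
               (extendAt p j q i ≡ extendAt p j q (i ∸ 1)) ⊎ (extendAt p j q i ≡ suc (extendAt p j q (i ∸ 1)))
      steps′ i 1≤i i≤sj with ≤-suc-cases i≤sj
      ... | inj₁ i≤j rewrite extendAt-old p j q i i≤j
                           | extendAt-old p j q (i ∸ 1) (≤-trans (m∸n≤m i 1) i≤j) = steps i 1≤i i≤j
      ... | inj₂ refl rewrite extendAt-new p j q | extendAt-old p j q j ≤-refl | pj = move
      avoids′ : Avoids φ (suc j) (extendAt p j q)
      avoids′ i 1≤i i≤sj with ≤-suc-cases i≤sj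
      ... | inj₁ i≤j  rewrite extendAt-old p j q i i≤j = avoids i 1≤i i≤j
      ... | inj₂ refl rewrite extendAt-new p j q = free

  reach-sound : ∀ j q → reach j q ≡ true → PathTo j q
  reach-sound zero q e = (λ _ → 0) , (refl , λ i 1≤i i≤0 → ⊥-elim (<⇒≱ 1≤i i≤0)) ,
                         (λ i 1≤i i≤0 → ⊥-elim (<⇒≱ 1≤i i≤0)) , sym (≡ᵇ-sound q 0 e)
  reach-sound (suc j) q e with ∧-true {not (φ (suc j) q)} e
  ... | free , moves with ∨-true {reach j q} moves
  ... | inj₁ stay = extend j q q (reach-sound j q stay) (not-true free) (inj₁ refl)
  reach-sound (suc j) (suc q) e | free , moves | inj₂ up =
    extend j (suc q) q (reach-sound j q up) (not-true free) (inj₂ refl)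

  module _ (sparse : ∀ j → j ≤ L → forbiddenUpTo j ≤ j) where

    -- Invariant: #reach j + forbiddenUpTo j ≥ j + 1; with sparseness it keeps
    -- the reachable set nonempty, which in turn lets the next column grow it.
    reach-size : ∀ j → j ≤ L → suc j ≤ #reach j + forbiddenUpTo j
    reach-nonempty : ∀ j → j ≤ L → 1 ≤ #reach j

    reach-size zero _ =
      ≤-trans (m≤m+n 1 _) (≤-trans (≤-reflexive (sym (sum<-++ (λ q → ind (reach 0 q)) 1 L))) (m≤m+n _ _))
    reach-size (suc j) sj≤L = begin
      suc (suc j)                                     ≤⟨ s≤s (reach-size j (<⇒≤ sj≤L)) ⟩
      suc (#reach j) + forbiddenUpTo j                ≤⟨ +-monoˡ-≤ _ (reach-step j sj≤L (reach-nonempty j (<⇒≤ sj≤L))) ⟩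
      #reach (suc j) + forbidden (suc j) + forbiddenUpTo j
        ≡⟨ solve 3 (λ a b c → a :+ b :+ c := a :+ (c :+ b)) refl (#reach (suc j)) (forbidden (suc j)) (forbiddenUpTo j) ⟩
      #reach (suc j) + forbiddenUpTo (suc j)          ∎
      where open ≤-Reasoning

    reach-nonempty j j≤L = +-cancelʳ-≤ (forbiddenUpTo j) 1 (#reach j)
      (≤-trans (+-monoʳ-≤ 1 (sparse j j≤L)) (reach-size j j≤L))

    path : ∃ λ p → ValidSeq L p × Avoids φ L p
    path with count-witness (reach L) (suc L) (reach-nonempty L ≤-refl)
    ... | q , _ , reached with reach-sound L q reached
    ... | p , valid , avoids , _ = p , valid , avoids

avoiding-path : ∀ (φ : ℕ → ℕ → Bool) L →
                (∀ j → j ≤ L → sum< (λ i → count (φ (suc i)) (suc L)) j ≤ j) →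
                ∃ λ p → ValidSeq L p × Avoids φ L p
avoiding-path φ L sparse = AvoidingPath.path φ L sparse

column# : ℕ → List Elem → ℕ
column# a []             = 0
column# a ((a′ , _) ∷ C) = ind (a ≡ᵇ a′) + column# a C

_≡ᴱ_ : Elem → Elem → Bool
(a , b) ≡ᴱ (a′ , b′) = (a ≡ᵇ a′) ∧ (b ≡ᵇ b′)

_∈ᵇ_ : Elem → List Elem → Bool
x ∈ᵇ []      = false
x ∈ᵇ (y ∷ C) = (x ≡ᴱ y) ∨ (x ∈ᵇ C)

∈⇒∈ᵇ : ∀ {x C} → x ∈ C → (x ∈ᵇ C) ≡ true
∈⇒∈ᵇ {a , b} (here refl) rewrite ≡ᵇ-refl a | ≡ᵇ-refl b = refl
∈⇒∈ᵇ {x} {y ∷ C} (there x∈C) rewrite ∈⇒∈ᵇ x∈C = ∨-zeroʳ (x ≡ᴱ y)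

∈⇒column#-pos : ∀ {a b C} → (a , b) ∈ C → 1 ≤ column# a C
∈⇒column#-pos {a} (here refl) rewrite ≡ᵇ-refl a = s≤s z≤n
∈⇒column#-pos (there ab∈C) = ≤-trans (∈⇒column#-pos ab∈C) (m≤n+m _ _)

column-rows : ∀ a C n → count (λ q → (a , q) ∈ᵇ C) n ≤ column# a C
column-rows a []               n = ≤-reflexive (sum<-zero n)
column-rows a ((a′ , b′) ∷ C) n = begin
  count (λ q → (a , q) ∈ᵇ ((a′ , b′) ∷ C)) n
    ≤⟨ sum<-mono n (λ q → ind-∨ ((a ≡ᵇ a′) ∧ (q ≡ᵇ b′)) ((a , q) ∈ᵇ C)) ⟩
  sum< (λ q → ind ((a ≡ᵇ a′) ∧ (q ≡ᵇ b′)) + ind ((a , q) ∈ᵇ C)) n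
    ≡⟨ sum<-+ _ _ n ⟩
  count (λ q → (a ≡ᵇ a′) ∧ (q ≡ᵇ b′)) n + count (λ q → (a , q) ∈ᵇ C) n
    ≤⟨ +-mono-≤ (head-cell (a ≡ᵇ a′)) (column-rows a C n) ⟩
  ind (a ≡ᵇ a′) + column# a C ∎
  where
    open ≤-Reasoning
    head-cell : ∀ c → count (λ q → c ∧ (q ≡ᵇ b′)) n ≤ ind c
    head-cell true  = count-≡ᵇ b′ n
    head-cell false = ≤-reflexive (sum<-zero n)

-- Distinct columns are disjoint, so the column counts total at most |C|.
columns-total : ∀ C t → sum< (λ j → column# j C) t ≤ length C
columns-total []               t = ≤-reflexive (sum<-zero t)
columns-total ((a′ , b′) ∷ C) t = begin
  sum< (λ j → ind (j ≡ᵇ a′) + column# j C) t   ≡⟨ sum<-+ _ _ t ⟩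
  count (_≡ᵇ a′) t + sum< (λ j → column# j C) t ≤⟨ +-mono-≤ (count-≡ᵇ a′ t) (columns-total C t) ⟩
  suc (length C)                                ∎
  where open ≤-Reasoning

firstRow : ℕ → List Elem
firstRow zero    = []
firstRow (suc n) = (n , 0) ∷ firstRow n

firstRow-length : ∀ n → length (firstRow n) ≡ n
firstRow-length zero    = refl
firstRow-length (suc n) = cong suc (firstRow-length n)

firstRow-fresh : ∀ n n′ → n ≤ n′ → All ((n′ , 0) ≢_) (firstRow n)
firstRow-fresh zero    n′ _     = []
firstRow-fresh (suc n) n′ n<n′ =
  (λ e → <-irrefl (sym (cong proj₁ e)) n<n′) ∷ firstRow-fresh n n′ (<⇒≤ n<n′)

firstRow-unique : ∀ n → Unique (firstRow n)
firstRow-unique zero    = []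
firstRow-unique (suc n) = firstRow-fresh n n ≤-refl ∷ firstRow-unique n

firstRow-∈ : ∀ n t → n < t → (n , 0) ∈ firstRow t
firstRow-∈ n (suc t) n<st with ≤-suc-cases n<st
... | inj₁ n<t  = there (firstRow-∈ n t n<t)
... | inj₂ refl = here refl

sizeX-pos : ∀ k t n → 0 < t → t ≤ k → 0 < sizeX k t n
sizeX-pos k t n t>0 t≤k with n ≤? ⌊ t ∸ 1 /2⌋
... | yes _ = m<n⇒0<n∸m (<-≤-trans (half<t t>0) t≤k)
  where
    half<t : ∀ {t} → 0 < t → ⌊ t /2⌋ < t
    half<t {suc t} _ = ⌊n/2⌋<n t
... | no  _ = m<n⇒0<n∸m (<-≤-trans (s≤s (⌊n/2⌋≤n (t ∸ 1))) (≤-trans (≤-reflexive (m+[n∸m]≡n t>0)) t≤k))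

firstRow-blocks : ∀ k t .{{_ : NonZero t}} → t ≤ k → BlocksF k t (firstRow t)
firstRow-blocks k t t≤k n p n<t _ =
  (n , 0) , firstRow-∈ n t n<t , inj₁ (refl , sizeX-pos k t n (>-nonZero⁻¹ t) t≤k)

module LowerBound (k t : ℕ) .{{_ : NonZero t}} (C : List Elem) where

  g : ℕ → ℕ
  g j = column# (j % t) C

  periodic : ∀ j → g (t + j) ≡ g j
  periodic j = cong (λ a → column# a C) (trans (cong (_% t) (+-comm t j)) ([m+n]%n≡m%n j t))

  deficient : length C < t → sum< g t < t
  deficient short = <-≤-trans (s≤s (≤-trans (≤-reflexive columns-mod) (columns-total C t))) short
    where
      columns-mod : sum< g t ≡ sum< (λ j → column# j C) t
      columns-mod = sum<-cong t (λ j j<t → cong (λ a → column# a C) (m<n⇒m%n≡m j<t))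

  module FromStart (m : ℕ) (m<t : m < t) (window : ∀ i → sum< (λ j → g (m + j)) (suc i) ≤ i) where

    start-column-empty : column# m C ≤ 0
    start-column-empty =
      subst (λ a → column# a C ≤ 0) (trans (cong (_% t) (+-identityʳ m)) (m<n⇒m%n≡m m<t)) (window 0)

    -- the tail of a block starting at X_m must avoid the cells of C
    L : ℕ
    L = k ∸ sizeX k t m

    φ : ℕ → ℕ → Bool
    φ i q = ((m + i) % t , q) ∈ᵇ C

    sparse : ∀ j → j ≤ L → sum< (λ i → count (φ (suc i)) (suc L)) j ≤ j
    sparse j _ = begin
      sum< (λ i → count (φ (suc i)) (suc L)) j ≤⟨ sum<-mono j (λ i → column-rows ((m + suc i) % t) C (suc L)) ⟩
      sum< (λ i → g (m + suc i)) j             ≤⟨ m≤n+m _ _ ⟩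
      g (m + 0) + sum< (λ i → g (m + suc i)) j ≡⟨ sum<-++ (λ i → g (m + i)) 1 j ⟨
      sum< (λ i → g (m + i)) (suc j)           ≤⟨ window j ⟩
      j                                        ∎
      where open ≤-Reasoning

    misses-block : ¬ BlocksF k t C
    misses-block blocks with avoiding-path φ L sparse
    ... | p , valid , avoids with blocks m p m<t valid
    ... | (a , b) , ab∈C , inj₁ (a≡m , _) =
      <⇒≱ (subst (λ a → 1 ≤ column# a C) a≡m (∈⇒column#-pos ab∈C)) start-column-empty
    ... | (a , b) , ab∈C , inj₂ (i , 1≤i , i≤L , a≡ , b≡) =
      true≢false (trans (sym (∈⇒∈ᵇ (subst₂ (λ u v → (u , v) ∈ C) a≡ b≡ ab∈C))) (avoids i 1≤i i≤L))
      where
        true≢false : true ≢ false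
        true≢false ()

  small-sets-miss-a-block : length C < t → ¬ BlocksF k t C
  small-sets-miss-a-block short with cycle-lemma t g periodic (deficient short)
  ... | m , m<t , window = FromStart.misses-block m m<t window

blocking-sets-are-large : ∀ k t .{{_ : NonZero t}} C → BlocksF k t C → t ≤ length C
blocking-sets-are-large k t C blocks with t ≤? length C
... | yes t≤|C| = t≤|C|
... | no  t≰|C| = ⊥-elim (LowerBound.small-sets-miss-a-block k t C (≰⇒> t≰|C|) blocks)

theorem1p2 : (k t : ℕ) → .{{_ : NonZero t}} → t ≤ k → TransversalSizeF k t t
theorem1p2 k t t≤k =
  (firstRow t , firstRow-unique t , firstRow-blocks k t t≤k , firstRow-length t) ,
  (λ C _ blocks → blocking-sets-are-large k t C blocks)
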